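{- Let $\Gamma=\mathrm{Dic}(n,R,T)$ be a distance-regular dicirculant, with $\lambda$ the number of common neighbours of two adjacent vertices and $\mu$ the number of common neighbours of two vertices at distance $2$. Then $|N(1)\cap N(\alpha^n)|\geq |T|$. In particular, $\lambda\geq |T|$ if $n\in R$, and $\mu\geq |T|$ if $n\notin R$.
   Context: $\mathrm{Dic}_n=\langle \alpha,\beta \mid \alpha^{2n}=1,\ \beta^2=\alpha^n,\ \beta^{ -1}\alpha\beta=\alpha^{ -1}\rangle$. For $R,T\subseteq\mathbb{Z}_{2n}$ with $0\notin R$, $R=-R$, $T=n+T$, $\mathrm{Dic}(n,R,T)$ is the Cayley graph $\mathrm{Cay}(\mathrm{Dic}_n,\alpha^R\cup\alpha^T\beta)$ with vertex set $\mathrm{Dic}_n$ and $g\sim h$ iff $g^{ -1}h\in\alpha^R\cup\alpha^T\beta$, where $\alpha^A=\{\alpha^a:a\in A\}$ and $\alpha^A\beta=\{\alpha^a\beta:a\in A\}$. $N(v)$ is the neighbourhood of $v$; $1$ is the identity of $\mathrm{Dic}_n$. Distance-regular: connected, and for vertices $u,v$ at distance $i$ the numbers of neighbours of $v$ at distance $i-1,i,i+1$ from $u$ depend only on $i$. -}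

module Defs where

open import Data.Nat using (ℕ; zero; suc; _+_; _*_; _∸_; NonZero; _≤_)
open import Data.Nat.Properties using (m*n≢0)
open import Data.Nat.DivMod using (_mod_)
open import Data.Fin using (Fin; toℕ)
open import Data.Fin.Properties using () renaming (_≟_ to _≟ᶠ_)
open import Data.Fin.Subset using (Subset)
open import Data.Bool using (Bool; true; false; _∧_; _∨_; not)
open import Data.Product using (_×_; _,_; ∃-syntax)
open import Data.List using (List; []; _∷_; length; filterᵇ; concatMap; allFin)
open import Data.Bool.ListAction using (any)
open import Data.Vec using (lookup)
open import Relation.Nullary.Decidable using (isYes)
open import Relation.Binary.PropositionalEquality using (_≡_)

module _ (n : ℕ) .{{nz : NonZero n}} where

  Zmod : Set
  Zmod = Fin (2 * n)

  ⟦_⟧ : ℕ → Zmod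
  ⟦ x ⟧ = _mod_ x (2 * n) {{m*n≢0 2 n}}

  add : Zmod → Zmod → Zmod
  add a c = ⟦ toℕ a + toℕ c ⟧

  ⊖ : Zmod → Zmod
  ⊖ a = ⟦ 2 * n ∸ toℕ a ⟧

  _⊝_ : Zmod → Zmod → Zmod
  a ⊝ c = add a (⊖ c)

  0ₘ : Zmod
  0ₘ = ⟦ 0 ⟧

  nₘ : Zmod
  nₘ = ⟦ n ⟧

  -- Dic_n in normal form: (a , false) = α^a,  (a , true) = α^a β
  Dic : Set
  Dic = Zmod × Bool

  -- multiplication, from β α^c = α^{-c} β and β² = α^n
  _·_ : Dic → Dic → Dic
  (a , false) · (c , f) = (add a c , f)
  (a , true) · (c , false) = (a ⊝ c , true)
  (a , true) · (c , true) = (add (a ⊝ c) nₘ , false)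

  inv : Dic → Dic
  inv (a , false) = (⊖ a , false)
  inv (a , true) = (add a nₘ , true)

  one : Dic
  one = (0ₘ , false)

  αⁿ : Dic
  αⁿ = (nₘ , false)

  eqD : Dic → Dic → Bool
  eqD (a , e) (c , f) = isYes (a ≟ᶠ c) ∧ eqB e f
    where
    eqB : Bool → Bool → Bool
    eqB true true = true
    eqB false false = true
    eqB _ _ = false

  elements : List (Dic)
  elements = concatMap (λ a → (a , false) ∷ (a , true) ∷ []) (allFin (2 * n))

  -- membership in the connection set α^R ∪ α^T β
  inConn : Subset (2 * n) → Subset (2 * n) → Dic → Bool
  inConn R T (a , false) = lookup R a
  inConn R T (a , true) = lookup T a

  adj : Subset (2 * n) → Subset (2 * n) → Dic → Dic → Bool
  adj R T g h = inConn R T (inv g · h)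

  count : (Dic → Bool) → ℕ
  count p = length (filterᵇ p elements)

  within : Subset (2 * n) → Subset (2 * n) → ℕ → Dic → Dic → Bool
  within R T zero u v = eqD u v
  within R T (suc k) u v =
    within R T k u v ∨ any (λ w → within R T k u w ∧ adj R T w v) elements

  atDist : Subset (2 * n) → Subset (2 * n) → Dic → Dic → ℕ → Bool
  atDist R T u v zero = eqD u v
  atDist R T u v (suc k) = within R T (suc k) u v ∧ not (within R T k u v)

  nbrsAt : Subset (2 * n) → Subset (2 * n) → Dic → Dic → ℕ → ℕ
  nbrsAt R T u v j = count (λ w → adj R T v w ∧ atDist R T u w j)

  commonNbrs : Subset (2 * n) → Subset (2 * n) → Dic → Dic → ℕ
  commonNbrs R T u v = count (λ w → adj R T u w ∧ adj R T v w)

  -- distance-regularity of Dic(n,R,T): connected, and for u,v at distance i the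
  -- number of neighbours of v at distance j ∈ {i-1,i,i+1} from u depends only on i (and j)
  DistanceRegular : Subset (2 * n) → Subset (2 * n) → Set
  DistanceRegular R T =
    (∀ (u v : Dic) → ∃[ k ] within R T k u v ≡ true) ×
    (∀ (i j : ℕ) (u v u′ v′ : Dic) → j ≤ suc i → i ≤ suc j →
       atDist R T u v i ≡ true → atDist R T u′ v′ i ≡ true →
       nbrsAt R T u v j ≡ nbrsAt R T u′ v′ j)

{-# OPTIONS --safe #-}
module Submission where

open import Data.Bool using (Bool; true; false; _∧_; _∨_)
open import Data.Bool.ListAction using (any)
open import Data.Bool.Properties using (T-≡; ∧-comm; ∧-identityʳ; ∨-identityʳ; ∨-zeroʳ)
open import Data.Empty using (⊥-elim)
open import Data.Fin using (Fin; toℕ) renaming (zero to fzero; suc to fsuc)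
open import Data.Fin.Properties using (toℕ-fromℕ<; toℕ-injective; toℕ<n) renaming (_≟_ to _≟ᶠ_)
open import Data.Fin.Subset using (Subset; _∈_; _∉_; ∣_∣)
open import Data.Fin.Subset.Properties using (Empty-unique; ∣⊥∣≡0; nonempty?)
open import Data.List using (List; []; _∷_; length; filterᵇ; concatMap; allFin; tabulate)
open import Data.List.Membership.Propositional using (lose) renaming (_∈_ to _∈ₗ_)
open import Data.List.Membership.Propositional.Properties using (∈-allFin; ∈-map⁺; ∈-concat⁺′)
open import Data.List.Relation.Unary.Any using (here; there)
open import Data.List.Relation.Unary.Any.Properties using (any⁺)
open import Data.Nat using (ℕ; NonZero; _≤_; _<_; _+_; _*_; _∸_; z≤n; s≤s; ≢-nonZero⁻¹)
open import Data.Nat.DivMod using (_%_; %-distribˡ-+; [m+n]%n≡m%n; m<n⇒m%n≡m)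
open import Data.Nat.Properties using (≤-refl; ≤-trans; m≤n⇒m≤1+n; +-identityʳ; +-assoc; m+[n∸m]≡n; m∸n+n≡m; m+n∸n≡m; <⇒≤; m*n≢0; m<m+n; n≢0⇒n>0)
open import Data.Nat.Tactic.RingSolver using (solve-∀)
open import Data.Product using (_×_; _,_; proj₁)
open import Data.Vec as Vec using (lookup; _∷_; [])
open import Data.Vec.Properties using ([]=⇒lookup; lookup⇒[]=)
open import Function.Base using (_∘_; id)
open import Function.Bundles using (_⇔_; Equivalence)
open import Relation.Nullary using (yes; no)
open import Relation.Binary.PropositionalEquality using (_≡_; _≢_; refl; sym; trans; cong; cong₂; subst; module ≡-Reasoning)
open ≡-Reasoning

open import Defs

-- For t ∈ T the vertex α^t β is adjacent to 1, and also to α^n because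
-- (α^n)⁻¹ α^t β = α^(n+t) β and n + T = T; hence α^T β ⊆ N(1) ∩ N(α^n).
-- As 0 ∉ R no vertex is its own neighbour, so |N(u) ∩ N(v)| is the number of
-- neighbours of v at distance 1 from u, which distance-regularity makes a function
-- of d(u, v) ≤ 2. Finally d(1, α^n) = 1 when n ∈ R, and d(1, α^n) = 2 when n ∉ R
-- and T ≠ ∅, witnessed by the walk 1 ~ α^t β ~ α^n.

module _ {A : Set} where

  filterᵇ-cong : {p q : A → Bool} → (∀ x → p x ≡ q x) → ∀ xs → filterᵇ p xs ≡ filterᵇ q xs
  filterᵇ-cong p≗q [] = refl
  filterᵇ-cong {p} {q} p≗q (x ∷ xs) rewrite p≗q x with q x
  ... | true  = cong (x ∷_) (filterᵇ-cong p≗q xs)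
  ... | false = filterᵇ-cong p≗q xs

  any-witness : (p : A → Bool) {x : A} {xs : List A} → x ∈ₗ xs → p x ≡ true → any p xs ≡ true
  any-witness p x∈xs px = Equivalence.to T-≡ (any⁺ p (lose x∈xs (Equivalence.from T-≡ px)))

  any-none : (p : A → Bool) → (∀ x → p x ≡ false) → ∀ xs → any p xs ≡ false
  any-none p ¬p [] = refl
  any-none p ¬p (x ∷ xs) rewrite ¬p x = any-none p ¬p xs

∣p∣≤length-filterᵇ-tabulate : ∀ {A : Set} {m} (p : Subset m) (g : Fin m → A) (q : A → Bool) →
  (∀ a → a ∈ p → q (g a) ≡ true) → ∣ p ∣ ≤ length (filterᵇ q (tabulate g))
∣p∣≤length-filterᵇ-tabulate [] g q p⇒q = z≤n
∣p∣≤length-filterᵇ-tabulate (true ∷ p) g q p⇒q rewrite p⇒q fzero Vec.here =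
  s≤s (∣p∣≤length-filterᵇ-tabulate p (g ∘ fsuc) q (λ a → p⇒q (fsuc a) ∘ Vec.there))
∣p∣≤length-filterᵇ-tabulate (false ∷ p) g q p⇒q
  with ih ← ∣p∣≤length-filterᵇ-tabulate p (g ∘ fsuc) q (λ a → p⇒q (fsuc a) ∘ Vec.there) | q (g fzero)
... | true  = m≤n⇒m≤1+n ih
... | false = ih

tagged : {A : Set} → A → List (A × Bool)
tagged a = (a , false) ∷ (a , true) ∷ []

length-filterᵇ-true-tagged≤ : ∀ {A : Set} (p : A × Bool → Bool) (xs : List A) →
  length (filterᵇ (λ a → p (a , true)) xs) ≤ length (filterᵇ p (concatMap tagged xs))
length-filterᵇ-true-tagged≤ p [] = z≤n
length-filterᵇ-true-tagged≤ p (x ∷ xs) with ih ← length-filterᵇ-true-tagged≤ p xs | p (x , false)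
length-filterᵇ-true-tagged≤ p (x ∷ xs) | false with p (x , true)
... | false = ih
... | true  = s≤s ih
length-filterᵇ-true-tagged≤ p (x ∷ xs) | true with p (x , true)
... | false = m≤n⇒m≤1+n ih
... | true  = s≤s (m≤n⇒m≤1+n ih)

module Dicirculant (n : ℕ) .{{_ : NonZero n}} where

  N : ℕ
  N = 2 * n

  instance
    nonZero-N : NonZero N
    nonZero-N = m*n≢0 2 n

  N≡n+n : N ≡ n + n
  N≡n+n = cong (n +_) (+-identityʳ n)

  n<N : n < N
  n<N = subst (n <_) (sym N≡n+n) (m<m+n n (n≢0⇒n>0 (≢-nonZero⁻¹ n)))

  ⟦_⟧ₘ : ℕ → Zmod n
  ⟦ x ⟧ₘ = ⟦_⟧ n x

  toℕ-⟦⟧ : ∀ x → toℕ ⟦ x ⟧ₘ ≡ x % N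
  toℕ-⟦⟧ x = toℕ-fromℕ< _

  ⟦⟧-cong-% : ∀ {x y} → x % N ≡ y % N → ⟦ x ⟧ₘ ≡ ⟦ y ⟧ₘ
  ⟦⟧-cong-% {x} {y} eq = toℕ-injective (trans (toℕ-⟦⟧ x) (trans eq (sym (toℕ-⟦⟧ y))))

  ⟦⟧-+N : ∀ x → ⟦ x + N ⟧ₘ ≡ ⟦ x ⟧ₘ
  ⟦⟧-+N x = ⟦⟧-cong-% ([m+n]%n≡m%n x N)

  ⟦toℕ⟧ : ∀ a → ⟦ toℕ a ⟧ₘ ≡ a
  ⟦toℕ⟧ a = toℕ-injective (trans (toℕ-⟦⟧ (toℕ a)) (m<n⇒m%n≡m (toℕ<n a)))

  add-⟦⟧ : ∀ x y → add n ⟦ x ⟧ₘ ⟦ y ⟧ₘ ≡ ⟦ x + y ⟧ₘ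
  add-⟦⟧ x y = ⟦⟧-cong-% (begin
    (toℕ ⟦ x ⟧ₘ + toℕ ⟦ y ⟧ₘ) % N  ≡⟨ cong₂ (λ a b → (a + b) % N) (toℕ-⟦⟧ x) (toℕ-⟦⟧ y) ⟩
    (x % N + y % N) % N            ≡⟨ %-distribˡ-+ x y N ⟨
    (x + y) % N                    ∎)

  toℕ-0ₘ : toℕ (0ₘ n) ≡ 0
  toℕ-0ₘ = trans (toℕ-⟦⟧ 0) (m<n⇒m%n≡m (≤-trans (s≤s z≤n) n<N))

  toℕ-nₘ : toℕ (nₘ n) ≡ n
  toℕ-nₘ = trans (toℕ-⟦⟧ n) (m<n⇒m%n≡m n<N)

  add-0ₘˡ : ∀ a → add n (0ₘ n) a ≡ a
  add-0ₘˡ a = begin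
    add n (0ₘ n) a           ≡⟨ cong (add n (0ₘ n)) (⟦toℕ⟧ a) ⟨
    add n ⟦ 0 ⟧ₘ ⟦ toℕ a ⟧ₘ  ≡⟨ add-⟦⟧ 0 (toℕ a) ⟩
    ⟦ toℕ a ⟧ₘ               ≡⟨ ⟦toℕ⟧ a ⟩
    a                        ∎

  add-nₘ-nₘ : ∀ a → add n (add n a (nₘ n)) (nₘ n) ≡ a
  add-nₘ-nₘ a = begin
    add n (add n a (nₘ n)) (nₘ n)       ≡⟨ cong (λ b → add n (add n b (nₘ n)) (nₘ n)) (⟦toℕ⟧ a) ⟨
    add n (add n ⟦ x ⟧ₘ ⟦ n ⟧ₘ) ⟦ n ⟧ₘ  ≡⟨ cong (λ b → add n b ⟦ n ⟧ₘ) (add-⟦⟧ x n) ⟩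
    add n ⟦ x + n ⟧ₘ ⟦ n ⟧ₘ             ≡⟨ add-⟦⟧ (x + n) n ⟩
    ⟦ x + n + n ⟧ₘ                      ≡⟨ cong ⟦_⟧ₘ x+n+n≡x+N ⟩
    ⟦ x + N ⟧ₘ                          ≡⟨ ⟦⟧-+N x ⟩
    ⟦ x ⟧ₘ                              ≡⟨ ⟦toℕ⟧ a ⟩
    a                                   ∎
    where
    x = toℕ a
    x+n+n≡x+N : x + n + n ≡ x + N
    x+n+n≡x+N = trans (+-assoc x n n) (cong (x +_) (sym N≡n+n))

  ⊖-0ₘ : ⊖ n (0ₘ n) ≡ 0ₘ n
  ⊖-0ₘ = trans (cong (λ k → ⟦ N ∸ k ⟧ₘ) toℕ-0ₘ) (⟦⟧-+N 0)

  ⊖-nₘ : ⊖ n (nₘ n) ≡ nₘ n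
  ⊖-nₘ = begin
    ⟦ N ∸ toℕ (nₘ n) ⟧ₘ  ≡⟨ cong (λ k → ⟦ N ∸ k ⟧ₘ) toℕ-nₘ ⟩
    ⟦ N ∸ n ⟧ₘ           ≡⟨ cong (λ k → ⟦ k ∸ n ⟧ₘ) N≡n+n ⟩
    ⟦ n + n ∸ n ⟧ₘ       ≡⟨ cong ⟦_⟧ₘ (m+n∸n≡m n n) ⟩
    ⟦ n ⟧ₘ               ∎

  ·-inverseˡ : ∀ u → _·_ n (inv n u) u ≡ one n
  ·-inverseˡ (a , false) = cong (_, false) (begin
    add n (⊖ n a) a             ≡⟨ cong (add n (⊖ n a)) (⟦toℕ⟧ a) ⟨
    add n ⟦ N ∸ x ⟧ₘ ⟦ x ⟧ₘ     ≡⟨ add-⟦⟧ (N ∸ x) x ⟩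
    ⟦ N ∸ x + x ⟧ₘ              ≡⟨ cong ⟦_⟧ₘ (m∸n+n≡m (<⇒≤ (toℕ<n a))) ⟩
    ⟦ 0 + N ⟧ₘ                  ≡⟨ ⟦⟧-+N 0 ⟩
    ⟦ 0 ⟧ₘ                      ∎)
    where x = toℕ a
  ·-inverseˡ (a , true) = cong (_, false) (begin
    add n (add n (add n a (nₘ n)) (⊖ n a)) (nₘ n)
      ≡⟨ cong (λ b → add n (add n (add n b ⟦ n ⟧ₘ) ⟦ N ∸ x ⟧ₘ) ⟦ n ⟧ₘ) (⟦toℕ⟧ a) ⟨
    add n (add n (add n ⟦ x ⟧ₘ ⟦ n ⟧ₘ) ⟦ N ∸ x ⟧ₘ) ⟦ n ⟧ₘ
      ≡⟨ cong (λ b → add n (add n b ⟦ N ∸ x ⟧ₘ) ⟦ n ⟧ₘ) (add-⟦⟧ x n) ⟩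
    add n (add n ⟦ x + n ⟧ₘ ⟦ N ∸ x ⟧ₘ) ⟦ n ⟧ₘ
      ≡⟨ cong (λ b → add n b ⟦ n ⟧ₘ) (add-⟦⟧ (x + n) (N ∸ x)) ⟩
    add n ⟦ x + n + (N ∸ x) ⟧ₘ ⟦ n ⟧ₘ
      ≡⟨ add-⟦⟧ (x + n + (N ∸ x)) n ⟩
    ⟦ x + n + (N ∸ x) + n ⟧ₘ
      ≡⟨ cong ⟦_⟧ₘ (rearrange x n (N ∸ x)) ⟩
    ⟦ x + (N ∸ x) + (n + n) ⟧ₘ
      ≡⟨ cong₂ (λ b c → ⟦ b + c ⟧ₘ) (m+[n∸m]≡n (<⇒≤ (toℕ<n a))) (sym N≡n+n) ⟩
    ⟦ N + N ⟧ₘ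
      ≡⟨ ⟦⟧-+N N ⟩
    ⟦ 0 + N ⟧ₘ
      ≡⟨ ⟦⟧-+N 0 ⟩
    ⟦ 0 ⟧ₘ
      ∎)
    where
    x = toℕ a
    rearrange : ∀ a b c → a + b + c + b ≡ a + c + (b + b)
    rearrange = solve-∀

  one≢αⁿ : one n ≢ αⁿ n
  one≢αⁿ one≡αⁿ = ≢-nonZero⁻¹ n (trans (sym toℕ-nₘ) (trans (cong (toℕ ∘ proj₁) (sym one≡αⁿ)) toℕ-0ₘ))

  eqD-sound : ∀ {u w} → eqD n u w ≡ true → u ≡ w
  eqD-sound {a , e} {c , f} eq with a ≟ᶠ c
  eqD-sound {a , true}  {.a , true}  eq | yes refl = refl
  eqD-sound {a , false} {.a , false} eq | yes refl = refl

  eqD-refl : ∀ u → eqD n u u ≡ true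
  eqD-refl (a , e) with a ≟ᶠ a
  eqD-refl (a , true)  | yes _ = refl
  eqD-refl (a , false) | yes _ = refl
  ... | no a≢a = ⊥-elim (a≢a refl)

  eqD-false : ∀ {u w} → u ≢ w → eqD n u w ≡ false
  eqD-false {u} {w} u≢w with eqD n u w in eq
  ... | true  = ⊥-elim (u≢w (eqD-sound eq))
  ... | false = refl

  ∈-elements : ∀ u → u ∈ₗ elements n
  ∈-elements (a , e) = ∈-concat⁺′ (∈-tagged e) (∈-map⁺ tagged (∈-allFin a))
    where
    ∈-tagged : ∀ e → (a , e) ∈ₗ tagged a
    ∈-tagged false = here refl
    ∈-tagged true  = there (here refl)

  any-elements-eqD-∧ : (f : Dic n → Bool) (u : Dic n) → any (λ x → eqD n u x ∧ f x) (elements n) ≡ f u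
  any-elements-eqD-∧ f u with f u in fu
  ... | true  = any-witness _ (∈-elements u) (cong₂ _∧_ (eqD-refl u) fu)
  ... | false = any-none _ eqD-∧-false (elements n)
    where
    eqD-∧-false : ∀ x → (eqD n u x ∧ f x) ≡ false
    eqD-∧-false x with eqD n u x in eq
    ... | true  = subst (λ y → f y ≡ false) (eqD-sound eq) fu
    ... | false = refl

  lookup-∉ : ∀ {p : Subset N} {a} → a ∉ p → lookup p a ≡ false
  lookup-∉ {p} {a} a∉p with lookup p a in eq
  ... | true  = ⊥-elim (a∉p (lookup⇒[]= a p eq))
  ... | false = refl

  ∣p∣≤count : (p : Subset N) (q : Dic n → Bool) → (∀ a → a ∈ p → q (a , true) ≡ true) → ∣ p ∣ ≤ count n q
  ∣p∣≤count p q p⇒q = ≤-trans (∣p∣≤length-filterᵇ-tabulate p id (λ a → q (a , true)) p⇒q)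
                              (length-filterᵇ-true-tagged≤ q (allFin N))

  module _ (R T : Subset N) where

    adj-one : ∀ w → adj n R T (one n) w ≡ inConn n R T w
    adj-one (c , f) rewrite ⊖-0ₘ | add-0ₘˡ c = refl

    adj-αⁿ-β : ∀ t → adj n R T (αⁿ n) (t , true) ≡ lookup T (add n (nₘ n) t)
    adj-αⁿ-β t rewrite ⊖-nₘ = refl

    adj-β-αⁿ : ∀ t → adj n R T (t , true) (αⁿ n) ≡ lookup T t
    adj-β-αⁿ t rewrite ⊖-nₘ | add-nₘ-nₘ t = refl

    adj-irrefl : 0ₘ n ∉ R → ∀ u → adj n R T u u ≡ false
    adj-irrefl 0∉R u rewrite ·-inverseˡ u = lookup-∉ 0∉R

    within-1 : ∀ u w → within n R T 1 u w ≡ (eqD n u w ∨ adj n R T u w)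
    within-1 u w = cong (eqD n u w ∨_) (any-elements-eqD-∧ (λ x → adj n R T x w) u)

    atDist-1 : 0ₘ n ∉ R → ∀ u w → atDist n R T u w 1 ≡ adj n R T u w
    atDist-1 0∉R u w rewrite within-1 u w with eqD n u w in eq
    ... | true  = sym (subst (λ x → adj n R T u x ≡ false) (eqD-sound eq) (adj-irrefl 0∉R u))
    ... | false = ∧-identityʳ _

    nbrsAt-1 : 0ₘ n ∉ R → ∀ u v → nbrsAt n R T u v 1 ≡ commonNbrs n R T u v
    nbrsAt-1 0∉R u v = cong length (filterᵇ-cong at-1≗common (elements n))
      where
      at-1≗common : ∀ w → (adj n R T v w ∧ atDist n R T u w 1) ≡ (adj n R T u w ∧ adj n R T v w)
      at-1≗common w = trans (cong (adj n R T v w ∧_) (atDist-1 0∉R u w)) (∧-comm (adj n R T v w) (adj n R T u w))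

    ∣T∣≤commonNbrs-one-αⁿ : (∀ a → (a ∈ T) ⇔ (add n (nₘ n) a ∈ T)) → ∣ T ∣ ≤ commonNbrs n R T (one n) (αⁿ n)
    ∣T∣≤commonNbrs-one-αⁿ T≡n+T = ∣p∣≤count T _ αᵃβ-common
      where
      αᵃβ-common : ∀ a → a ∈ T → (adj n R T (one n) (a , true) ∧ adj n R T (αⁿ n) (a , true)) ≡ true
      αᵃβ-common a a∈T rewrite adj-one (a , true) | adj-αⁿ-β a | []=⇒lookup a∈T =
        []=⇒lookup (Equivalence.to (T≡n+T a) a∈T)

    commonNbrs-regular : 0ₘ n ∉ R → DistanceRegular n R T → ∀ {i} u v u′ v′ → i ≤ 2 →
      atDist n R T u v i ≡ true → atDist n R T u′ v′ i ≡ true →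
      commonNbrs n R T u v ≡ commonNbrs n R T u′ v′
    commonNbrs-regular 0∉R (_ , regular) {i} u v u′ v′ i≤2 uv u′v′ = begin
      commonNbrs n R T u v    ≡⟨ nbrsAt-1 0∉R u v ⟨
      nbrsAt n R T u v 1      ≡⟨ regular i 1 u v u′ v′ (s≤s z≤n) i≤2 uv u′v′ ⟩
      nbrsAt n R T u′ v′ 1    ≡⟨ nbrsAt-1 0∉R u′ v′ ⟩
      commonNbrs n R T u′ v′  ∎

    atDist-one-αⁿ-1 : 0ₘ n ∉ R → nₘ n ∈ R → atDist n R T (one n) (αⁿ n) 1 ≡ true
    atDist-one-αⁿ-1 0∉R n∈R = trans (atDist-1 0∉R (one n) (αⁿ n)) (trans (adj-one (αⁿ n)) ([]=⇒lookup n∈R))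

    within-1-one-αⁿ : nₘ n ∉ R → within n R T 1 (one n) (αⁿ n) ≡ false
    within-1-one-αⁿ n∉R rewrite within-1 (one n) (αⁿ n) | adj-one (αⁿ n) | lookup-∉ n∉R =
      trans (∨-identityʳ (eqD n (one n) (αⁿ n))) (eqD-false one≢αⁿ)

    walk-one-αᵗβ-αⁿ : ∀ {t} → t ∈ T → any (λ w → within n R T 1 (one n) w ∧ adj n R T w (αⁿ n)) (elements n) ≡ true
    walk-one-αᵗβ-αⁿ {t} t∈T = any-witness _ (∈-elements (t , true)) one-αᵗβ-αⁿ
      where
      one-αᵗβ-αⁿ : (within n R T 1 (one n) (t , true) ∧ adj n R T (t , true) (αⁿ n)) ≡ true
      one-αᵗβ-αⁿ rewrite within-1 (one n) (t , true) | adj-one (t , true) | adj-β-αⁿ t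
                       | []=⇒lookup t∈T | ∨-zeroʳ (eqD n (one n) (t , true)) = refl

    atDist-one-αⁿ-2 : nₘ n ∉ R → ∀ {t} → t ∈ T → atDist n R T (one n) (αⁿ n) 2 ≡ true
    atDist-one-αⁿ-2 n∉R t∈T rewrite within-1-one-αⁿ n∉R | walk-one-αᵗβ-αⁿ t∈T = refl

open Dicirculant

lemma3p4 : ∀ (n : ℕ) .{{_ : NonZero n}} (R T : Subset (2 * n)) →
    0ₘ n ∉ R →
    (∀ a → (a ∈ R) ⇔ (⊖ n a ∈ R)) →
    (∀ a → (a ∈ T) ⇔ (add n (nₘ n) a ∈ T)) →
    DistanceRegular n R T →
    (∣ T ∣ ≤ commonNbrs n R T (one n) (αⁿ n))
    × (nₘ n ∈ R → ∀ u v → adj n R T u v ≡ true → ∣ T ∣ ≤ commonNbrs n R T u v)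
    × (nₘ n ∉ R → ∀ u v → atDist n R T u v 2 ≡ true → ∣ T ∣ ≤ commonNbrs n R T u v)
lemma3p4 n R T 0∉R _ T≡n+T dr = ∣T∣≤common , λ-bound , μ-bound
  where
  ∣T∣≤common : ∣ T ∣ ≤ commonNbrs n R T (one n) (αⁿ n)
  ∣T∣≤common = ∣T∣≤commonNbrs-one-αⁿ n R T T≡n+T

  λ-bound : nₘ n ∈ R → ∀ u v → adj n R T u v ≡ true → ∣ T ∣ ≤ commonNbrs n R T u v
  λ-bound n∈R u v uv = subst (∣ T ∣ ≤_)
    (commonNbrs-regular n R T 0∉R dr (one n) (αⁿ n) u v (s≤s z≤n)
      (atDist-one-αⁿ-1 n R T 0∉R n∈R) (trans (atDist-1 n R T 0∉R u v) uv))
    ∣T∣≤common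

  μ-bound : nₘ n ∉ R → ∀ u v → atDist n R T u v 2 ≡ true → ∣ T ∣ ≤ commonNbrs n R T u v
  μ-bound n∉R u v uv with nonempty? T
  ... | yes (t , t∈T) = subst (∣ T ∣ ≤_)
    (commonNbrs-regular n R T 0∉R dr (one n) (αⁿ n) u v ≤-refl (atDist-one-αⁿ-2 n R T n∉R t∈T) uv)
    ∣T∣≤common
  ... | no T-empty rewrite Empty-unique T-empty | ∣⊥∣≡0 (2 * n) = z≤n
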